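{- Let $a,b,n$ be natural numbers with $a+b<n$ and $a<\frac{n}{2}<b$. Let $\mathcal{F}$ be an inclusion-maximal independent set of $\Gamma(n,a,b)$ and let $B\subseteq[n]$ with $|B|=b$. Then the $\mathcal{F}$-weight of $B$ equals $\binom{b}{a}$ if and only if every flag $(A',B')\in\mathcal{F}$ satisfies $A'\cap B\neq\emptyset$ or $B\cup B'\neq[n]$.
   Context: $[n]=\{1,\dots,n\}$. The graph $\Gamma(n,a,b)$ has as vertices the pairs (flags) $(A,B)$ with $A\subseteq B\subseteq[n]$, $|A|=a$, $|B|=b$; under the assumptions $a+b<n$ and $a<n/2<b$, two vertices $(A_1,B_1),(A_2,B_2)$ are adjacent (called opposite) iff $B_1\cup B_2=[n]$, $A_1\cap B_2=\emptyset$ and $A_2\cap B_1=\emptyset$. An independent set is a set of pairwise non-adjacent vertices. For an independent set $\mathcal{F}$ and $B\subseteq[n]$ with $|B|=b$, the $\mathcal{F}$-weight of $B$ is the number of flags in $\mathcal{F}$ whose second component is $B$. -}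

module Defs where

open import Data.Nat using (ℕ; zero; suc)
open import Data.Bool using (Bool; true; false; _∨_; _∧_)
open import Data.Vec using (Vec; []; _∷_)
open import Data.List using (List; []; _∷_; _++_; map; filter; length)
open import Data.Fin using (Fin)
open import Data.Fin.Subset using (Subset; _⊆_; _∩_; _∪_; ∣_∣; ⊤; Empty)
open import Data.Product using (_×_; ∃)
open import Relation.Nullary using (¬_; Dec; yes; no)
open import Relation.Binary.PropositionalEquality using (_≡_)
open import Data.Vec.Properties using (≡-dec)
import Data.Bool as 𝔹

_≟ₛ_ : {n : ℕ} → (p q : Subset n) → Dec (p ≡ q)
_≟ₛ_ = ≡-dec 𝔹._≟_

allSubsets : (n : ℕ) → List (Subset n)
allSubsets zero = [] ∷ []
allSubsets (suc n) = map (true ∷_) (allSubsets n) ++ map (false ∷_) (allSubsets n)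

IsFlag : (n a b : ℕ) → Subset n → Subset n → Set
IsFlag n a b A B = (A ⊆ B) × (∣ A ∣ ≡ a) × (∣ B ∣ ≡ b)

-- opposition (adjacency) of two flags
Opposite : {n : ℕ} → (Subset n × Subset n) → (Subset n × Subset n) → Set
Opposite {n} (A₁ Data.Product., B₁) (A₂ Data.Product., B₂) =
  (B₁ ∪ B₂ ≡ ⊤) × Empty (A₁ ∩ B₂) × Empty (A₂ ∩ B₁)

-- a set of vertices of Γ(n,a,b), given by its characteristic function on pairs
-- of subsets (it may only contain flags)
Family : ℕ → Set
Family n = Subset n → Subset n → Bool

IsVertexSet : (n a b : ℕ) → Family n → Set
IsVertexSet n a b 𝓕 = ∀ A B → 𝓕 A B ≡ true → IsFlag n a b A B

Independent : (n : ℕ) → Family n → Set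
Independent n 𝓕 = ∀ A₁ B₁ A₂ B₂ → 𝓕 A₁ B₁ ≡ true → 𝓕 A₂ B₂ ≡ true →
  ¬ Opposite (A₁ Data.Product., B₁) (A₂ Data.Product., B₂)

insert : {n : ℕ} → Subset n → Subset n → Family n → Family n
insert A B 𝓕 A' B' with A' ≟ₛ A | B' ≟ₛ B
... | yes _ | yes _ = true
... | _ | _ = 𝓕 A' B'

MaximalIndependent : (n a b : ℕ) → Family n → Set
MaximalIndependent n a b 𝓕 =
  IsVertexSet n a b 𝓕 × Independent n 𝓕 ×
  (∀ A B → IsFlag n a b A B → 𝓕 A B ≡ false → ¬ Independent n (insert A B 𝓕))

weight : (n : ℕ) → Family n → Subset n → ℕ
weight n 𝓕 B = length (filter (λ A → Data.Bool._≟_ (𝓕 A B) true) (allSubsets n))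

-- A flag (A, B) ∈ 𝓕 has A an a-subset of B, so the weight of B is at most (b choose a), with
-- equality exactly when (A, B) ∈ 𝓕 for every a-subset A of B. In that case a flag (A', B') ∈ 𝓕
-- with A' ∩ B = ∅ and B ∪ B' = [n] is impossible: the complement of B' has n − b ≥ a elements
-- and lies in B, so an a-subset A of it gives a flag (A, B) ∈ 𝓕 opposite to (A', B').
-- Conversely, if no flag of 𝓕 is opposite to a flag (A, B), a missing (A, B) could be added
-- to 𝓕 keeping it independent ((A, B) is not opposite to itself as B ≠ [n]), against
-- maximality.
module Submission where

open import Defs
open import Data.Nat using (ℕ; zero; suc; _+_; _*_; _≤_; _<_; s≤s)
open import Data.Nat.Properties
  using (suc-injective; _≟_; ≤-trans; m≤n+m; m+n≤o⇒m≤o∸n; <⇒≤; <-irrefl)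
open import Data.Nat.Combinatorics using (_C_; nCk+nC[k+1]≡[n+1]C[k+1])
open import Data.Bool using (true; false)
import Data.Bool as 𝔹
open import Data.List using (List; []; _∷_; _++_; map; filter; length)
open import Data.List.Properties
  using (filter-++; length-++; length-map; filter-complete; filter-≐; filter-none)
open import Data.List.Membership.Propositional using () renaming (_∈_ to _∈ˡ_)
open import Data.List.Membership.Propositional.Properties
  using (∈-filter⁺; ∈-filter⁻; ∈-map⁺; ∈-++⁺ˡ; ∈-++⁺ʳ)
open import Data.List.Relation.Unary.All using (universal)
import Data.List.Relation.Unary.Any as Any
open import Data.Vec using ([]; _∷_; here)
open import Data.Fin.Subset using (Subset; _∈_; _⊆_; ∣_∣; _∪_; _∩_; ∁; ⊤; ⊥; Empty)
open import Data.Fin.Subset.Properties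
  using (_⊆?_; ⊆-trans; out⊆-⇔; in⊆in-⇔; s⊆s; ⊥⊆; ∣⊥∣≡0; ∣⊤∣≡n; ∣∁p∣≡n∸∣p∣; nonempty?;
         x∈p∪q⁻; x∈p∩q⁻; x∈∁p⇒x∉p; ∈⊤; ∪-comm; ∪-idem)
open import Data.Product using (_×_; _,_; ∃; proj₁; proj₂)
import Data.Product as Product
open import Data.Sum using (_⊎_; inj₁; inj₂)
open import Function using (_∘_)
open import Level using (Level; 0ℓ)
open import Function.Bundles using (_⇔_; mk⇔; Equivalence)
open import Relation.Nullary using (¬_; yes; no; contradiction)
open import Relation.Nullary.Decidable using (_×-dec_)
open import Relation.Unary using (Pred; Decidable)
open import Relation.Binary.PropositionalEquality
  using (_≡_; refl; sym; trans; cong; cong₂; subst; module ≡-Reasoning)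

module _ {a p q : Level} {A : Set a} {P : Pred A p} {Q : Pred A q}
         (P? : Decidable P) (Q? : Decidable Q) where

  filter-filter-⇒ : (∀ {x} → P x → Q x) → ∀ xs → filter P? (filter Q? xs) ≡ filter P? xs
  filter-filter-⇒ P⇒Q [] = refl
  filter-filter-⇒ P⇒Q (x ∷ xs) with Q? x
  ... | yes _ with P? x
  ...   | yes _ = cong (x ∷_) (filter-filter-⇒ P⇒Q xs)
  ...   | no _  = filter-filter-⇒ P⇒Q xs
  filter-filter-⇒ P⇒Q (x ∷ xs) | no ¬Qx with P? x
  ...   | yes Px = contradiction (P⇒Q Px) ¬Qx
  ...   | no _   = filter-filter-⇒ P⇒Q xs

  length-filter-≡⇒⇐ : (∀ {x} → P x → Q x) → ∀ {xs} →
    length (filter P? xs) ≡ length (filter Q? xs) → ∀ {x} → x ∈ˡ xs → Q x → P x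
  length-filter-≡⇒⇐ P⇒Q {xs} eq x∈xs Qx =
    proj₂ (∈-filter⁻ P? {xs = filter Q? xs}
      (subst (_ ∈ˡ_) (sym P-keeps-all) (∈-filter⁺ Q? x∈xs Qx)))
    where
    P-keeps-all : filter P? (filter Q? xs) ≡ filter Q? xs
    P-keeps-all = filter-complete P? (trans (cong length (filter-filter-⇒ P⇒Q xs)) eq)

filter-map : ∀ {a b p} {A : Set a} {B : Set b} {P : Pred B p} (P? : Decidable P) (f : A → B) xs →
  filter P? (map f xs) ≡ map f (filter (P? ∘ f) xs)
filter-map P? f [] = refl
filter-map P? f (x ∷ xs) with P? (f x)
... | yes _ = cong (f x ∷_) (filter-map P? f xs)
... | no _  = filter-map P? f xs

∈-allSubsets : ∀ {n} (A : Subset n) → A ∈ˡ allSubsets n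
∈-allSubsets [] = Any.here refl
∈-allSubsets {suc n} (true ∷ A) = ∈-++⁺ˡ (∈-map⁺ (true ∷_) (∈-allSubsets A))
∈-allSubsets {suc n} (false ∷ A) =
  ∈-++⁺ʳ (map (true ∷_) (allSubsets n)) (∈-map⁺ (false ∷_) (∈-allSubsets A))

length-filter-allSubsets : ∀ {n p} {P : Pred (Subset (suc n)) p} (P? : Decidable P) →
  length (filter P? (allSubsets (suc n))) ≡
  length (filter (P? ∘ (true ∷_)) (allSubsets n)) + length (filter (P? ∘ (false ∷_)) (allSubsets n))
length-filter-allSubsets {n} P? = begin
  length (filter P? (map (true ∷_) S ++ map (false ∷_) S))
    ≡⟨ cong length (filter-++ P? (map (true ∷_) S) (map (false ∷_) S)) ⟩
  length (filter P? (map (true ∷_) S) ++ filter P? (map (false ∷_) S))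
    ≡⟨ length-++ (filter P? (map (true ∷_) S)) ⟩
  length (filter P? (map (true ∷_) S)) + length (filter P? (map (false ∷_) S))
    ≡⟨ cong₂ _+_ (length-filter-map (true ∷_)) (length-filter-map (false ∷_)) ⟩
  length (filter (P? ∘ (true ∷_)) S) + length (filter (P? ∘ (false ∷_)) S) ∎
  where
  open ≡-Reasoning
  S : List (Subset n)
  S = allSubsets n
  length-filter-map : (f : Subset n → Subset (suc n)) →
    length (filter P? (map f S)) ≡ length (filter (P? ∘ f) S)
  length-filter-map f = trans (cong length (filter-map P? f S)) (length-map f (filter (P? ∘ f) S))

SubsetOfSize : ∀ {n} → Subset n → ℕ → Pred (Subset n) 0ℓ
SubsetOfSize B k A = A ⊆ B × ∣ A ∣ ≡ k

subsetOfSize? : ∀ {n} (B : Subset n) (k : ℕ) → Decidable (SubsetOfSize B k)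
subsetOfSize? B k A = A ⊆? B ×-dec ∣ A ∣ ≟ k

length-filter-subsetOfSize : ∀ {n} (B : Subset n) (k : ℕ) →
  length (filter (subsetOfSize? B k) (allSubsets n)) ≡ ∣ B ∣ C k
length-filter-subsetOfSize [] zero = refl
length-filter-subsetOfSize [] (suc k) = refl
length-filter-subsetOfSize {suc n} (y ∷ B) k =
  trans (length-filter-allSubsets (subsetOfSize? (y ∷ B) k)) (pascal y k)
  where
  #_ : ∀ {P : Pred (Subset n) 0ℓ} → Decidable P → ℕ
  # P? = length (filter P? (allSubsets n))

  none : ∀ {P : Pred (Subset n) 0ℓ} (P? : Decidable P) → (∀ A → ¬ P A) → # P? ≡ 0
  none P? ¬P = cong length (filter-none P? (universal ¬P (allSubsets n)))

  outside : ∀ {y} k → # (subsetOfSize? (y ∷ B) k ∘ (false ∷_)) ≡ ∣ B ∣ C k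
  outside k = trans
    (cong length (filter-≐ _ (subsetOfSize? B k)
      (Product.map₁ (Equivalence.from out⊆-⇔) , Product.map₁ (Equivalence.to out⊆-⇔))
      (allSubsets n)))
    (length-filter-subsetOfSize B k)

  inside : ∀ k → # (subsetOfSize? (true ∷ B) (suc k) ∘ (true ∷_)) ≡ ∣ B ∣ C k
  inside k = trans
    (cong length (filter-≐ _ (subsetOfSize? B k)
      (Product.map (Equivalence.from in⊆in-⇔) suc-injective ,
       Product.map (Equivalence.to in⊆in-⇔) (cong suc)) (allSubsets n)))
    (length-filter-subsetOfSize B k)

  pascal : ∀ y k →
    # (subsetOfSize? (y ∷ B) k ∘ (true ∷_)) + # (subsetOfSize? (y ∷ B) k ∘ (false ∷_))
      ≡ ∣ y ∷ B ∣ C k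
  pascal false k = cong₂ _+_ (none _ (λ _ (A⊆B , _) → contradiction (A⊆B here) λ ())) (outside k)
  pascal true zero = cong₂ _+_ (none _ (λ _ ())) (outside zero)
  pascal true (suc k) =
    trans (cong₂ _+_ (inside k) (outside (suc k))) (nCk+nC[k+1]≡[n+1]C[k+1] ∣ B ∣ k)

∃-subsetOfSize : ∀ {n} (S : Subset n) {k} → k ≤ ∣ S ∣ → ∃ (SubsetOfSize S k)
∃-subsetOfSize {n} S {zero} _ = ⊥ , ⊥⊆ , ∣⊥∣≡0 n
∃-subsetOfSize (true ∷ S) {suc k} (s≤s k≤∣S∣) =
  let A , A⊆S , ∣A∣≡k = ∃-subsetOfSize S k≤∣S∣ in true ∷ A , s⊆s A⊆S , cong suc ∣A∣≡k
∃-subsetOfSize (false ∷ S) {suc k} k≤∣S∣ =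
  let A , A⊆S , ∣A∣≡k = ∃-subsetOfSize S k≤∣S∣ in false ∷ A , s⊆s A⊆S , ∣A∣≡k

Opposite-sym : ∀ {n} {A₁ B₁ A₂ B₂ : Subset n} →
  Opposite (A₁ , B₁) (A₂ , B₂) → Opposite (A₂ , B₂) (A₁ , B₁)
Opposite-sym {B₁ = B₁} {B₂ = B₂} (B₁∪B₂≡⊤ , A₁∩B₂≡∅ , A₂∩B₁≡∅) =
  trans (∪-comm B₂ B₁) B₁∪B₂≡⊤ , A₂∩B₁≡∅ , A₁∩B₂≡∅

insert-true⁻ : ∀ {n} (A B : Subset n) (𝓕 : Family n) A' B' →
  insert A B 𝓕 A' B' ≡ true → (A' ≡ A × B' ≡ B) ⊎ 𝓕 A' B' ≡ true
insert-true⁻ A B 𝓕 A' B' e with A' ≟ₛ A | B' ≟ₛ B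
... | yes A'≡A | yes B'≡B = inj₁ (A'≡A , B'≡B)
... | yes _    | no _     = inj₂ e
... | no _     | _        = inj₂ e

insert-independent : ∀ {n} {A B : Subset n} {𝓕 : Family n} → Independent n 𝓕 →
  ¬ Opposite (A , B) (A , B) →
  (∀ A' B' → 𝓕 A' B' ≡ true → ¬ Opposite (A , B) (A' , B')) →
  Independent n (insert A B 𝓕)
insert-independent {A = A} {B} {𝓕} 𝓕-indep ¬self ¬opp A₁ B₁ A₂ B₂ e₁ e₂
  with insert-true⁻ A B 𝓕 A₁ B₁ e₁ | insert-true⁻ A B 𝓕 A₂ B₂ e₂
... | inj₁ (refl , refl) | inj₁ (refl , refl) = ¬self
... | inj₁ (refl , refl) | inj₂ f₂ = ¬opp A₂ B₂ f₂
... | inj₂ f₁ | inj₁ (refl , refl) = ¬opp A₁ B₁ f₁ ∘ Opposite-sym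
... | inj₂ f₁ | inj₂ f₂ = 𝓕-indep A₁ B₁ A₂ B₂ f₁ f₂

⊆∁⇒∩-Empty : ∀ {n} {A B : Subset n} → A ⊆ ∁ B → Empty (A ∩ B)
⊆∁⇒∩-Empty {A = A} {B} A⊆∁B (x , x∈A∩B) =
  let x∈A , x∈B = x∈p∩q⁻ A B x∈A∩B in x∈∁p⇒x∉p (A⊆∁B x∈A) x∈B

∪≡⊤⇒∁⊆ : ∀ {n} {B B' : Subset n} → B ∪ B' ≡ ⊤ → ∁ B' ⊆ B
∪≡⊤⇒∁⊆ {B = B} {B'} B∪B'≡⊤ {x} x∈∁B' with x∈p∪q⁻ B B' (subst (x ∈_) (sym B∪B'≡⊤) ∈⊤)
... | inj₁ x∈B  = x∈B
... | inj₂ x∈B' = contradiction x∈B' (x∈∁p⇒x∉p x∈∁B')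

∪-self≢⊤ : ∀ {n} {B : Subset n} → ∣ B ∣ < n → ¬ B ∪ B ≡ ⊤
∪-self≢⊤ {n} {B} ∣B∣<n B∪B≡⊤ =
  <-irrefl (trans (cong ∣_∣ (trans (sym (∪-idem B)) B∪B≡⊤)) (∣⊤∣≡n n)) ∣B∣<n

Saturated : ∀ {n} → Family n → ℕ → Subset n → Set
Saturated 𝓕 a B = ∀ A → SubsetOfSize B a A → 𝓕 A B ≡ true

weight≡C⇔saturated : ∀ {n a b} {𝓕 : Family n} {B : Subset n} →
  IsVertexSet n a b 𝓕 → ∣ B ∣ ≡ b → (weight n 𝓕 B ≡ b C a) ⇔ Saturated 𝓕 a B
weight≡C⇔saturated {n} {a} {b} {𝓕} {B} vertices ∣B∣≡b = mk⇔
  (λ w A A∈Q → length-filter-≡⇒⇐ inB? (subsetOfSize? B a) inB⇒ofSize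
                 (trans w (sym #subsetsOfSize)) (∈-allSubsets A) A∈Q)
  (λ saturated → trans (cong length (filter-≐ inB? (subsetOfSize? B a)
                          (inB⇒ofSize , saturated _) (allSubsets n)))
                        #subsetsOfSize)
  where
  inB? : Decidable (λ A → 𝓕 A B ≡ true)
  inB? A = 𝓕 A B 𝔹.≟ true

  inB⇒ofSize : ∀ {A} → 𝓕 A B ≡ true → SubsetOfSize B a A
  inB⇒ofSize {A} e = let A⊆B , ∣A∣≡a , _ = vertices A B e in A⊆B , ∣A∣≡a

  #subsetsOfSize : length (filter (subsetOfSize? B a) (allSubsets n)) ≡ b C a
  #subsetsOfSize = trans (length-filter-subsetOfSize B a) (cong (_C a) ∣B∣≡b)

∃-opposite-subsetOfSize : ∀ {n a} {B A' B' : Subset n} → a + ∣ B' ∣ ≤ n →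
  B ∪ B' ≡ ⊤ → Empty (A' ∩ B) → ∃ λ A → SubsetOfSize B a A × Opposite (A , B) (A' , B')
∃-opposite-subsetOfSize {a = a} {B' = B'} a+∣B'∣≤n B∪B'≡⊤ A'∩B≡∅ =
  let A , A⊆∁B' , ∣A∣≡a = ∃-subsetOfSize (∁ B') a≤∣∁B'∣
  in A , (⊆-trans A⊆∁B' (∪≡⊤⇒∁⊆ B∪B'≡⊤) , ∣A∣≡a) , B∪B'≡⊤ , ⊆∁⇒∩-Empty A⊆∁B' , A'∩B≡∅
  where
  a≤∣∁B'∣ : a ≤ ∣ ∁ B' ∣
  a≤∣∁B'∣ = subst (a ≤_) (sym (∣∁p∣≡n∸∣p∣ B')) (m+n≤o⇒m≤o∸n a a+∣B'∣≤n)

separated⇒¬Opposite : ∀ {n} {A B A' B' : Subset n} →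
  ¬ Empty (A' ∩ B) ⊎ ¬ B ∪ B' ≡ ⊤ → ¬ Opposite (A , B) (A' , B')
separated⇒¬Opposite (inj₁ A'∩B≢∅) (_ , _ , A'∩B≡∅) = A'∩B≢∅ A'∩B≡∅
separated⇒¬Opposite (inj₂ B∪B'≢⊤) (B∪B'≡⊤ , _) = B∪B'≢⊤ B∪B'≡⊤

lemma2p4 : (n a b : ℕ) → a + b < n → 2 * a < n → n < 2 * b →
    (𝓕 : Family n) → MaximalIndependent n a b 𝓕 →
    (B : Subset n) → ∣ B ∣ ≡ b →
    (weight n 𝓕 B ≡ b C a) ⇔
      (∀ A' B' → 𝓕 A' B' ≡ true → ¬ Empty (A' ∩ B) ⊎ ¬ (B ∪ B' ≡ ⊤))
lemma2p4 n a b a+b<n _ _ 𝓕 (vertices , independent , maximal) B ∣B∣≡b =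
  mk⇔ (saturated⇒separated ∘ Equivalence.to weight⇔)
      (Equivalence.from weight⇔ ∘ separated⇒saturated)
  where
  Separated : Set
  Separated = ∀ A' B' → 𝓕 A' B' ≡ true → ¬ Empty (A' ∩ B) ⊎ ¬ (B ∪ B' ≡ ⊤)

  weight⇔ : (weight n 𝓕 B ≡ b C a) ⇔ Saturated 𝓕 a B
  weight⇔ = weight≡C⇔saturated vertices ∣B∣≡b

  saturated⇒separated : Saturated 𝓕 a B → Separated
  saturated⇒separated saturated A' B' f with (B ∪ B') ≟ₛ ⊤ | nonempty? (A' ∩ B)
  ... | no B∪B'≢⊤  | _            = inj₂ B∪B'≢⊤
  ... | yes _      | yes A'∩B≢∅   = inj₁ (λ A'∩B≡∅ → A'∩B≡∅ A'∩B≢∅)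
  ... | yes B∪B'≡⊤ | no A'∩B≡∅ =
    let ∣B'∣≡b = proj₂ (proj₂ (vertices A' B' f))
        A , A∈Q , opposite = ∃-opposite-subsetOfSize
          (subst (λ k → a + k ≤ n) (sym ∣B'∣≡b) (<⇒≤ a+b<n)) B∪B'≡⊤ A'∩B≡∅
    in contradiction opposite (independent A B A' B' (saturated A A∈Q) f)

  separated⇒saturated : Separated → Saturated 𝓕 a B
  separated⇒saturated separated A (A⊆B , ∣A∣≡a) with 𝓕 A B in 𝓕AB
  ... | true  = refl
  ... | false = contradiction
    (insert-independent independent (∪-self≢⊤ ∣B∣<n ∘ proj₁)
      (λ A' B' f → separated⇒¬Opposite (separated A' B' f)))
    (maximal A B (A⊆B , ∣A∣≡a , ∣B∣≡b) 𝓕AB)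
    where
    ∣B∣<n : ∣ B ∣ < n
    ∣B∣<n = subst (_< n) (sym ∣B∣≡b) (≤-trans (s≤s (m≤n+m b a)) a+b<n)
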